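{- Let $P(x)\in\mathbb{Z}[x]$ be a polynomial of degree $d\ge 2$ with positive leading coefficient, having at least two distinct complex roots, and such that $P(n)>0$ for all integers $n>0$. Let $a,b$ be distinct positive integers. Then the polynomial $a\cdot P(y)-b\cdot P(x)\in\mathbb{C}[x,y]$ has no factor in $\mathbb{C}[x,y]$ of degree $1$. -}

module Defs where

open import Level using (Level; _⊔_; suc)
open import Algebra.Bundles using (CommutativeRing)
open import Data.Nat as ℕ using (ℕ; zero; _<_) renaming (suc to 1+)
open import Data.Integer as ℤ using (ℤ; +_; -[1+_])
open import Data.Fin using (Fin; fromℕ; fromℕ<)
open import Relation.Nullary using (yes; no)
open import Data.Vec using (Vec; lookup)
open import Data.Product using (Σ; ∃; _×_; _,_)
open import Data.Sum using (_⊎_)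
open import Relation.Nullary using (¬_)

record Field (c ℓ : Level) : Set (Level.suc (c ⊔ ℓ)) where
  field
    commRing : CommutativeRing c ℓ
  open CommutativeRing commRing public
  field
    1≉0     : ¬ (1# ≈ 0#)
    inverse : ∀ x → ¬ (x ≈ 0#) → ∃ λ y → (x * y) ≈ 1#

module FieldOps {c ℓ} (K : Field c ℓ) where
  open Field K

  ℕ→K : ℕ → Carrier
  ℕ→K zero   = 0#
  ℕ→K (1+ n) = 1# + ℕ→K n

  ℤ→K : ℤ → Carrier
  ℤ→K (+ n)      = ℕ→K n
  ℤ→K -[1+ n ]   = - ℕ→K (1+ n)

  _^_ : Carrier → ℕ → Carrier
  x ^ zero   = 1#
  x ^ 1+ n   = x * (x ^ n)

  evalK : (n : ℕ) → (ℕ → Carrier) → Carrier → Carrier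
  evalK zero   f x = f 0
  evalK (1+ n) f x = evalK n f x + (f (1+ n) * (x ^ 1+ n))

  CharZero : Set ℓ
  CharZero = ∀ n → ¬ (ℕ→K (1+ n) ≈ 0#)

  AlgClosed : Set (c ⊔ ℓ)
  AlgClosed = ∀ (m : ℕ) (f : ℕ → Carrier) → ¬ (f (1+ m) ≈ 0#) →
              ∃ λ r → evalK (1+ m) f r ≈ 0#

  -- Polynomials in K[x,y]: coefficient function (i ↦ x-degree,
  -- j ↦ y-degree) with finite support (all coefficients of total
  -- degree above `bound` vanish).
  record Poly₂ : Set (c ⊔ ℓ) where
    field
      coeff : ℕ → ℕ → Carrier
      bound : ℕ
      finite : ∀ i j → bound < i ℕ.+ j → coeff i j ≈ 0#

  -- coefficient of x^i y^j in (α x + β y + γ) · Q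
  linMulCoeff : Carrier → Carrier → Carrier → Poly₂ → ℕ → ℕ → Carrier
  linMulCoeff α β γ Q i j = (xpart i + ypart j) + (γ * Poly₂.coeff Q i j)
    where
      xpart : ℕ → Carrier
      xpart zero   = 0#
      xpart (1+ i′) = α * Poly₂.coeff Q i′ j
      ypart : ℕ → Carrier
      ypart zero   = 0#
      ypart (1+ j′) = β * Poly₂.coeff Q i j′

  HasLinearFactor : (ℕ → ℕ → Carrier) → Set (c ⊔ ℓ)
  HasLinearFactor F =
    Σ Carrier λ α → Σ Carrier λ β → Σ Carrier λ γ →
      (¬ (α ≈ 0#) ⊎ ¬ (β ≈ 0#)) ×
      Σ Poly₂ λ Q → ∀ i j → linMulCoeff α β γ Q i j ≈ F i j

-- Integer polynomials of degree d, as a coefficient vector c₀ … c_d.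

coeffℤ : ∀ {d} → Vec ℤ (1+ d) → ℕ → ℤ
coeffℤ {d} cs i with i ℕ.<? 1+ d
... | yes i<  = lookup cs (fromℕ< i<)
... | no _    = + 0

evalℤ : ∀ {d} → Vec ℤ (1+ d) → ℤ → ℤ
evalℤ {d} cs x = go (1+ d)
  where
    go : ℕ → ℤ
    go zero     = + 0
    go (1+ k)   = go k ℤ.+ (coeffℤ cs k ℤ.* (x ℤ.^ k))

leadℤ : ∀ {d} → Vec ℤ (1+ d) → ℤ
leadℤ {d} cs = lookup cs (fromℕ d)

module _ {c ℓ} (K : Field c ℓ) where
  open Field K
  open FieldOps K

  evalℤK : ∀ {d} → Vec ℤ (1+ d) → Carrier → Carrier
  evalℤK {d} cs r = evalK d (λ i → ℤ→K (coeffℤ cs i)) r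

  -- coefficient array of  a·P(y) − b·P(x)  in K[x,y]
  -- (coefficient of x^i y^j)
  diffPolyℤ : ℕ → ℕ → ∀ {d} → Vec ℤ (1+ d) → ℕ → ℕ → ℤ
  diffPolyℤ a b cs zero    zero    = (+ a ℤ.- + b) ℤ.* coeffℤ cs 0
  diffPolyℤ a b cs zero    (1+ j)  = + a ℤ.* coeffℤ cs (1+ j)
  diffPolyℤ a b cs (1+ i)  zero    = ℤ.- (+ b ℤ.* coeffℤ cs (1+ i))
  diffPolyℤ a b cs (1+ i)  (1+ j)  = + 0

  diffPoly : ℕ → ℕ → ∀ {d} → Vec ℤ (1+ d) → ℕ → ℕ → Carrier
  diffPoly a b cs i j = ℤ→K (diffPolyℤ a b cs i j)

{-# OPTIONS --safe #-}
-- A factorisation a·P(y) − b·P(x) = (αx + βy + γ)·Q(x, y) gives a·P(y) = b·P(x) at every point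
-- of the line αx + βy + γ = 0. A vertical or horizontal line would make P constant, but over an
-- algebraically closed field P takes both the values 0 and 1. Otherwise the line is the graph of an
-- affine bijection σ with a·P(σ x) = b·P(x), so σ permutes the finitely many roots of P. A common
-- period N of two distinct roots makes the affine map σᴺ fix two points, so σᴺ = id, and then
-- aᴺ·P(x) = bᴺ·P(x) at a point where P(x) = 1 gives aᴺ = bᴺ, i.e. a = b.

module Submission where

open import Defs
open import Data.Nat as ℕ using (ℕ; zero; _≤_; _<_; z≤n; s≤s; _∸_) renaming (suc to 1+)
import Data.Nat.Properties as ℕ
open import Data.Nat.GeneralisedArithmetic using (fold; fold-+)
open import Data.Integer as ℤ using (ℤ; +_; +[1+_]; -[1+_]; 0ℤ; _⊖_) renaming (_<_ to _<ℤ_)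
import Data.Integer.Properties as ℤ
open import Data.Sign as Sign using (Sign)
open import Data.Vec using (Vec; lookup)
open import Data.Fin using (fromℕ; fromℕ<)
import Data.Fin.Properties as Fin
open import Data.Product using (Σ; ∃; ∃₂; _×_; _,_)
open import Data.Sum using (_⊎_; [_,_])
open import Data.Empty using (⊥; ⊥-elim)
open import Data.Maybe using (Maybe; just; nothing)
open import Algebra.Solver.Ring.AlmostCommutativeRing using (fromCommutativeRing; _-Raw-AlmostCommutative⟶_)
open import Relation.Nullary using (¬_; yes; no)
open import Relation.Binary.PropositionalEquality as ≡ using (_≡_; _≢_)
open import Relation.Binary.Definitions using (tri<; tri≈; tri>)

^-injectiveˡ : ∀ n {a b} → a ℕ.^ 1+ n ≡ b ℕ.^ 1+ n → a ≡ b
^-injectiveˡ n {a} {b} aⁿ≡bⁿ with ℕ.<-cmp a b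
... | tri< a<b _ _ = ⊥-elim (ℕ.<-irrefl aⁿ≡bⁿ (ℕ.^-monoˡ-< (1+ n) a<b))
... | tri≈ _ a≡b _ = a≡b
... | tri> _ _ a>b = ⊥-elim (ℕ.<-irrefl (≡.sym aⁿ≡bⁿ) (ℕ.^-monoˡ-< (1+ n) a>b))

module _ {c ℓ} (K : Field c ℓ) where
  open Field K
  open FieldOps K
  open import Relation.Binary.Reasoning.Setoid setoid
  open import Algebra.Properties.Ring ring using (-‿distribˡ-*; -‿distribʳ-*)
  open import Algebra.Properties.AbelianGroup +-abelianGroup using (⁻¹-∙-comm)
  open import Algebra.Properties.Group +-group using (⁻¹-involutive; ⁻¹-injective; ε⁻¹≈ε; x∙y⁻¹≈ε⇒x≈y; x≈y⇒x∙y⁻¹≈ε) renaming (∙-cancelˡ to +-cancelˡ)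
  open import Algebra.Properties.CommutativeSemigroup +-commutativeSemigroup using (interchange)
  open import Algebra.Properties.Semiring.Mult semiring using (×-homo-+; ×1-homo-*) renaming (_×_ to _×ₙ_)

  -- The canonical ring homomorphism ℤ → K

  ℕ→K≡×1# : ∀ n → ℕ→K n ≡ n ×ₙ 1#
  ℕ→K≡×1# zero   = ≡.refl
  ℕ→K≡×1# (1+ n) = ≡.cong (λ x → 1# + x) (ℕ→K≡×1# n)

  ℕ→K-+ : ∀ m n → ℕ→K (m ℕ.+ n) ≈ ℕ→K m + ℕ→K n
  ℕ→K-+ m n rewrite ℕ→K≡×1# (m ℕ.+ n) | ℕ→K≡×1# m | ℕ→K≡×1# n = ×-homo-+ 1# m n

  ℕ→K-* : ∀ m n → ℕ→K (m ℕ.* n) ≈ ℕ→K m * ℕ→K n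
  ℕ→K-* m n rewrite ℕ→K≡×1# (m ℕ.* n) | ℕ→K≡×1# m | ℕ→K≡×1# n = ×1-homo-* m n

  ℤ→K-neg : ∀ i → ℤ→K (ℤ.- i) ≈ - ℤ→K i
  ℤ→K-neg -[1+ n ]   = sym (⁻¹-involutive _)
  ℤ→K-neg (+ zero)   = sym ε⁻¹≈ε
  ℤ→K-neg +[1+ n ]   = refl

  ℤ→K-⊖ : ∀ m n → ℤ→K (m ⊖ n) ≈ ℕ→K m - ℕ→K n
  ℤ→K-⊖ m      zero   = sym (trans (+-congˡ ε⁻¹≈ε) (+-identityʳ _))
  ℤ→K-⊖ zero   (1+ n) = sym (+-identityˡ _)
  ℤ→K-⊖ (1+ m) (1+ n) = begin
    ℤ→K (1+ m ⊖ 1+ n)                     ≡⟨ ≡.cong ℤ→K (ℤ.[1+m]⊖[1+n]≡m⊖n m n) ⟩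
    ℤ→K (m ⊖ n)                           ≈⟨ ℤ→K-⊖ m n ⟩
    ℕ→K m - ℕ→K n                         ≈⟨ sym (+-identityˡ _) ⟩
    0# + (ℕ→K m - ℕ→K n)                  ≈⟨ +-congʳ (sym (-‿inverseʳ 1#)) ⟩
    (1# - 1#) + (ℕ→K m - ℕ→K n)           ≈⟨ interchange 1# (- 1#) (ℕ→K m) (- ℕ→K n) ⟩
    (1# + ℕ→K m) + (- 1# - ℕ→K n)         ≈⟨ +-congˡ (⁻¹-∙-comm 1# (ℕ→K n)) ⟩
    (1# + ℕ→K m) - (1# + ℕ→K n)           ∎

  ℤ→K-+ : ∀ i j → ℤ→K (i ℤ.+ j) ≈ ℤ→K i + ℤ→K j
  ℤ→K-+ -[1+ m ] -[1+ n ] = begin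
    - ℕ→K (1+ (1+ (m ℕ.+ n)))             ≡⟨ ≡.cong (λ k → - ℕ→K (1+ k)) (ℕ.+-suc m n) ⟨
    - ℕ→K (1+ m ℕ.+ 1+ n)                 ≈⟨ -‿cong (ℕ→K-+ (1+ m) (1+ n)) ⟩
    - (ℕ→K (1+ m) + ℕ→K (1+ n))           ≈⟨ ⁻¹-∙-comm _ _ ⟨
    - ℕ→K (1+ m) - ℕ→K (1+ n)             ∎
  ℤ→K-+ -[1+ m ] (+ n)    = trans (ℤ→K-⊖ n (1+ m)) (+-comm _ _)
  ℤ→K-+ (+ m)    -[1+ n ] = ℤ→K-⊖ m (1+ n)
  ℤ→K-+ (+ m)    (+ n)    = ℕ→K-+ m n

  signed : Sign → Carrier → Carrier
  signed Sign.+ x = x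
  signed Sign.- x = - x

  signed-cong : ∀ s {x y} → x ≈ y → signed s x ≈ signed s y
  signed-cong Sign.+ p = p
  signed-cong Sign.- p = -‿cong p

  signed-* : ∀ s t x y → signed (s Sign.* t) (x * y) ≈ signed s x * signed t y
  signed-* Sign.- Sign.- x y = begin
    x * y         ≈⟨ ⁻¹-involutive _ ⟨
    - - (x * y)   ≈⟨ -‿cong (-‿distribˡ-* x y) ⟩
    - (- x * y)   ≈⟨ -‿distribʳ-* (- x) y ⟩
    - x * - y     ∎
  signed-* Sign.- Sign.+ x y = -‿distribˡ-* x y
  signed-* Sign.+ Sign.- x y = -‿distribʳ-* x y
  signed-* Sign.+ Sign.+ x y = refl

  ℤ→K-◃ : ∀ s n → ℤ→K (s ℤ.◃ n) ≈ signed s (ℕ→K n)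
  ℤ→K-◃ Sign.- zero   = sym ε⁻¹≈ε
  ℤ→K-◃ Sign.+ zero   = refl
  ℤ→K-◃ Sign.- (1+ n) = refl
  ℤ→K-◃ Sign.+ (1+ n) = refl

  ℤ→K≈signed∣∣ : ∀ i → ℤ→K i ≈ signed (ℤ.sign i) (ℕ→K ℤ.∣ i ∣)
  ℤ→K≈signed∣∣ -[1+ n ] = refl
  ℤ→K≈signed∣∣ (+ zero) = refl
  ℤ→K≈signed∣∣ +[1+ n ] = refl

  ℤ→K-* : ∀ i j → ℤ→K (i ℤ.* j) ≈ ℤ→K i * ℤ→K j
  ℤ→K-* i j = begin
    ℤ→K (i ℤ.* j)                             ≈⟨ ℤ→K-◃ s (ℤ.∣ i ∣ ℕ.* ℤ.∣ j ∣) ⟩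
    signed s (ℕ→K (ℤ.∣ i ∣ ℕ.* ℤ.∣ j ∣))        ≈⟨ signed-cong s (ℕ→K-* ℤ.∣ i ∣ ℤ.∣ j ∣) ⟩
    signed s (ℕ→K ℤ.∣ i ∣ * ℕ→K ℤ.∣ j ∣)        ≈⟨ signed-* (ℤ.sign i) (ℤ.sign j) _ _ ⟩
    signed (ℤ.sign i) (ℕ→K ℤ.∣ i ∣) * signed (ℤ.sign j) (ℕ→K ℤ.∣ j ∣) ≈⟨ *-cong (ℤ→K≈signed∣∣ i) (ℤ→K≈signed∣∣ j) ⟨
    ℤ→K i * ℤ→K j                             ∎
    where s = ℤ.sign i Sign.* ℤ.sign j

  ℤ→K-homomorphism : ℤ.+-*-rawRing -Raw-AlmostCommutative⟶ fromCommutativeRing commRing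
  ℤ→K-homomorphism = record
    { ⟦_⟧    = ℤ→K
    ; +-homo = ℤ→K-+
    ; *-homo = ℤ→K-*
    ; -‿homo = ℤ→K-neg
    ; 0-homo = refl
    ; 1-homo = +-identityʳ 1#
    }

  ℤ→K-≟ : ∀ i j → Maybe (ℤ→K i ≈ ℤ→K j)
  ℤ→K-≟ i j with i ℤ.≟ j
  ... | yes ≡.refl = just refl
  ... | no _       = nothing

  open import Algebra.Solver.Ring ℤ.+-*-rawRing (fromCommutativeRing commRing) ℤ→K-homomorphism ℤ→K-≟
    using (solve; _:=_; _:+_; _:*_; :-_; _:-_)

  x≉0⇒x*y≈0⇒y≈0 : ∀ {x y} → ¬ x ≈ 0# → x * y ≈ 0# → y ≈ 0#
  x≉0⇒x*y≈0⇒y≈0 {x} {y} x≉0 xy≈0 with inverse x x≉0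
  ... | x⁻¹ , xx⁻¹≈1 = begin
    y              ≈⟨ *-identityˡ y ⟨
    1# * y         ≈⟨ *-congʳ xx⁻¹≈1 ⟨
    (x * x⁻¹) * y  ≈⟨ solve 3 (λ x x⁻¹ y → (x :* x⁻¹) :* y := x⁻¹ :* (x :* y)) refl x x⁻¹ y ⟩
    x⁻¹ * (x * y)  ≈⟨ *-congˡ xy≈0 ⟩
    x⁻¹ * 0#       ≈⟨ zeroʳ x⁻¹ ⟩
    0#             ∎

  -x≉0 : ∀ {x} → ¬ x ≈ 0# → ¬ - x ≈ 0#
  -x≉0 x≉0 -x≈0 = x≉0 (⁻¹-injective (trans -x≈0 (sym ε⁻¹≈ε)))

  x*y≉0 : ∀ {x y} → ¬ x ≈ 0# → ¬ y ≈ 0# → ¬ x * y ≈ 0#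
  x*y≉0 x≉0 y≉0 xy≈0 = y≉0 (x≉0⇒x*y≈0⇒y≈0 x≉0 xy≈0)

  x*y≈1⇒y≉0 : ∀ {x y} → x * y ≈ 1# → ¬ y ≈ 0#
  x*y≈1⇒y≉0 {x} xy≈1 y≈0 = 1≉0 (trans (sym xy≈1) (trans (*-congˡ y≈0) (zeroʳ x)))

  x*[-y*x⁻¹]+y≈0 : ∀ {x x⁻¹} → x * x⁻¹ ≈ 1# → ∀ y → x * - (y * x⁻¹) + y ≈ 0#
  x*[-y*x⁻¹]+y≈0 {x} {x⁻¹} xx⁻¹≈1 y = begin
    x * - (y * x⁻¹) + y  ≈⟨ solve 3 (λ x x⁻¹ y → x :* :- (y :* x⁻¹) :+ y := y :- y :* (x :* x⁻¹)) refl x x⁻¹ y ⟩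
    y - y * (x * x⁻¹)    ≈⟨ +-congˡ (-‿cong (trans (*-congˡ xx⁻¹≈1) (*-identityʳ y))) ⟩
    y - y                ≈⟨ -‿inverseʳ y ⟩
    0#                   ∎

  ℕ→K-injective : CharZero → ∀ m n → ℕ→K m ≈ ℕ→K n → m ≡ n
  ℕ→K-injective char0 zero   zero   _ = ≡.refl
  ℕ→K-injective char0 zero   (1+ n) e = ⊥-elim (char0 n (sym e))
  ℕ→K-injective char0 (1+ m) zero   e = ⊥-elim (char0 m e)
  ℕ→K-injective char0 (1+ m) (1+ n) e = ≡.cong 1+ (ℕ→K-injective char0 m n (+-cancelˡ 1# _ _ e))

  ℕ→K-^ : ∀ a n → ℕ→K (a ℕ.^ n) ≈ ℕ→K a ^ n
  ℕ→K-^ a zero   = +-identityʳ 1#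
  ℕ→K-^ a (1+ n) = trans (ℕ→K-* a (a ℕ.^ n)) (*-congˡ (ℕ→K-^ a n))

  ℕ→K-equalPowers⇒≡ : CharZero → ∀ a b k → ℕ→K a ^ 1+ k ≈ ℕ→K b ^ 1+ k → a ≡ b
  ℕ→K-equalPowers⇒≡ char0 a b k equal =
    ^-injectiveˡ k (ℕ→K-injective char0 _ _ (trans (ℕ→K-^ a (1+ k)) (trans equal (sym (ℕ→K-^ b (1+ k))))))

  ℤ→K-positive≉0 : CharZero → ∀ i → 0ℤ <ℤ i → ¬ ℤ→K i ≈ 0#
  ℤ→K-positive≉0 char0 +[1+ n ] _          = char0 n
  ℤ→K-positive≉0 char0 (+ zero) (ℤ.+<+ ())

  -- Evaluation of polynomials in one variable

  ^-congˡ : ∀ n {x y} → x ≈ y → x ^ n ≈ y ^ n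
  ^-congˡ zero    _   = refl
  ^-congˡ (1+ n) x≈y = *-cong x≈y (^-congˡ n x≈y)

  evalK-cong : ∀ n {f g} → (∀ k → k ≤ n → f k ≈ g k) → ∀ x → evalK n f x ≈ evalK n g x
  evalK-cong zero    f≈g x = f≈g 0 z≤n
  evalK-cong (1+ n) f≈g x =
    +-cong (evalK-cong n (λ k k≤n → f≈g k (ℕ.m≤n⇒m≤1+n k≤n)) x) (*-congʳ (f≈g (1+ n) ℕ.≤-refl))

  evalK-congʳ : ∀ n f {x y} → x ≈ y → evalK n f x ≈ evalK n f y
  evalK-congʳ zero    f x≈y = refl
  evalK-congʳ (1+ n) f x≈y = +-cong (evalK-congʳ n f x≈y) (*-congˡ (^-congˡ (1+ n) x≈y))

  evalK-+ : ∀ n f g x → evalK n (λ k → f k + g k) x ≈ evalK n f x + evalK n g x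
  evalK-+ zero    f g x = refl
  evalK-+ (1+ n) f g x = begin
    evalK n (λ k → f k + g k) x + (f (1+ n) + g (1+ n)) * x ^ 1+ n
      ≈⟨ +-cong (evalK-+ n f g x) (distribʳ _ _ _) ⟩
    (evalK n f x + evalK n g x) + (f (1+ n) * x ^ 1+ n + g (1+ n) * x ^ 1+ n)
      ≈⟨ interchange _ _ _ _ ⟩
    (evalK n f x + f (1+ n) * x ^ 1+ n) + (evalK n g x + g (1+ n) * x ^ 1+ n)
      ∎

  evalK-* : ∀ n w f x → evalK n (λ k → w * f k) x ≈ w * evalK n f x
  evalK-* zero    w f x = refl
  evalK-* (1+ n) w f x = begin
    evalK n (λ k → w * f k) x + w * f (1+ n) * x ^ 1+ n ≈⟨ +-cong (evalK-* n w f x) (*-assoc _ _ _) ⟩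
    w * evalK n f x + w * (f (1+ n) * x ^ 1+ n)          ≈⟨ distribˡ _ _ _ ⟨
    w * (evalK n f x + f (1+ n) * x ^ 1+ n)              ∎

  evalK-zero : ∀ n f x → (∀ k → f k ≈ 0#) → evalK n f x ≈ 0#
  evalK-zero zero    f x f≈0 = f≈0 0
  evalK-zero (1+ n) f x f≈0 =
    trans (+-cong (evalK-zero n f x f≈0) (trans (*-congʳ (f≈0 (1+ n))) (zeroˡ _))) (+-identityʳ 0#)

  evalK-suc : ∀ m f x → evalK (1+ m) f x ≈ f 0 + x * evalK m (λ k → f (1+ k)) x
  evalK-suc zero    f x = +-congˡ (trans (*-congˡ (*-identityʳ x)) (*-comm _ _))
  evalK-suc (1+ m) f x = begin
    evalK (1+ m) f x + f (2 ℕ.+ m) * x ^ (2 ℕ.+ m)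
      ≈⟨ +-congʳ (evalK-suc m f x) ⟩
    f 0 + x * evalK m (λ k → f (1+ k)) x + f (2 ℕ.+ m) * (x * x ^ 1+ m)
      ≈⟨ solve 5 (λ a x e b p → a :+ x :* e :+ b :* (x :* p) := a :+ x :* (e :+ b :* p)) refl _ _ _ _ _ ⟩
    f 0 + x * evalK (1+ m) (λ k → f (1+ k)) x
      ∎

  evalK-dropTop : ∀ n f x → f (1+ n) ≈ 0# → evalK (1+ n) f x ≈ evalK n f x
  evalK-dropTop n f x top≈0 = trans (+-congˡ (trans (*-congʳ top≈0) (zeroˡ _))) (+-identityʳ _)

  evalK-extend : ∀ m n f x → (∀ k → n < k → f k ≈ 0#) → evalK (m ℕ.+ n) f x ≈ evalK n f x
  evalK-extend zero    n f x high≈0 = refl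
  evalK-extend (1+ m) n f x high≈0 =
    trans (evalK-dropTop (m ℕ.+ n) f x (high≈0 _ (s≤s (ℕ.m≤n+m n m)))) (evalK-extend m n f x high≈0)

  shift : (ℕ → Carrier) → ℕ → Carrier
  shift g zero   = 0#
  shift g (1+ k) = g k

  evalK-shift : ∀ m g x → evalK (1+ m) (shift g) x ≈ x * evalK m g x
  evalK-shift m g x = trans (evalK-suc m (shift g) x) (+-identityˡ _)

  -- Evaluation of polynomials in two variables

  eval₂ : ℕ → (ℕ → ℕ → Carrier) → Carrier → Carrier → Carrier
  eval₂ n F x y = evalK n (λ j → evalK n (λ i → F i j) x) y

  eval₂-cong : ∀ n {F G} → (∀ i j → F i j ≈ G i j) → ∀ x y → eval₂ n F x y ≈ eval₂ n G x y
  eval₂-cong n F≈G x y = evalK-cong n (λ j _ → evalK-cong n (λ i _ → F≈G i j) x) y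

  eval₂-+ : ∀ n F G x y → eval₂ n (λ i j → F i j + G i j) x y ≈ eval₂ n F x y + eval₂ n G x y
  eval₂-+ n F G x y = trans (evalK-cong n (λ j _ → evalK-+ n _ _ x) y) (evalK-+ n _ _ y)

  eval₂-* : ∀ n w F x y → eval₂ n (λ i j → w * F i j) x y ≈ w * eval₂ n F x y
  eval₂-* n w F x y = trans (evalK-cong n (λ j _ → evalK-* n w _ x) y) (evalK-* n w _ y)

  eval₂-shiftˣ : ∀ m F x y → (∀ j → F (1+ m) j ≈ 0#) →
                 eval₂ (1+ m) (λ i j → shift (λ i′ → F i′ j) i) x y ≈ x * eval₂ (1+ m) F x y
  eval₂-shiftˣ m F x y top≈0 = begin
    eval₂ (1+ m) (λ i j → shift (λ i′ → F i′ j) i) x y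
      ≈⟨ evalK-cong (1+ m) (λ j _ → evalK-shift m _ x) y ⟩
    evalK (1+ m) (λ j → x * evalK m (λ i → F i j) x) y
      ≈⟨ evalK-* (1+ m) x _ y ⟩
    x * evalK (1+ m) (λ j → evalK m (λ i → F i j) x) y
      ≈⟨ *-congˡ (evalK-cong (1+ m) (λ j _ → evalK-dropTop m _ x (top≈0 j)) y) ⟨
    x * eval₂ (1+ m) F x y
      ∎

  eval₂-shiftʸ : ∀ m F x y → (∀ i → F i (1+ m) ≈ 0#) →
                 eval₂ (1+ m) (λ i j → shift (F i) j) x y ≈ y * eval₂ (1+ m) F x y
  eval₂-shiftʸ m F x y top≈0 = begin
    eval₂ (1+ m) (λ i j → shift (F i) j) x y  ≈⟨ evalK-cong (1+ m) (λ j _ → column j) y ⟩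
    evalK (1+ m) (shift G) y                   ≈⟨ evalK-shift m G y ⟩
    y * evalK m G y                            ≈⟨ *-congˡ (evalK-dropTop m G y (evalK-zero (1+ m) _ x top≈0)) ⟨
    y * eval₂ (1+ m) F x y                     ∎
    where
    G : ℕ → Carrier
    G j = evalK (1+ m) (λ i → F i j) x
    column : ∀ j → evalK (1+ m) (λ i → shift (F i) j) x ≈ shift G j
    column zero   = evalK-zero (1+ m) _ x (λ _ → refl)
    column (1+ j) = refl

  eval₂-linMulCoeff : ∀ α β γ (Q : Poly₂) m → Poly₂.bound Q ≤ m → ∀ x y →
    eval₂ (1+ m) (linMulCoeff α β γ Q) x y ≈ (α * x + β * y + γ) * eval₂ (1+ m) (Poly₂.coeff Q) x y
  eval₂-linMulCoeff α β γ Q m bound≤m x y = begin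
    eval₂ N (linMulCoeff α β γ Q) x y                     ≈⟨ eval₂-cong N split x y ⟩
    eval₂ N (λ i j → (X i j + Y i j) + γ * q i j) x y     ≈⟨ eval₂-+ N _ _ x y ⟩
    eval₂ N (λ i j → X i j + Y i j) x y + eval₂ N γq x y  ≈⟨ +-cong (eval₂-+ N X Y x y) (eval₂-* N γ q x y) ⟩
    (eval₂ N X x y + eval₂ N Y x y) + γ * E               ≈⟨ +-congʳ (+-cong X-part Y-part) ⟩
    (x * (α * E) + y * (β * E)) + γ * E
      ≈⟨ solve 6 (λ x y α β γ E → x :* (α :* E) :+ y :* (β :* E) :+ γ :* E := (α :* x :+ β :* y :+ γ) :* E) refl x y α β γ E ⟩
    (α * x + β * y + γ) * E                               ∎
    where
    N = 1+ m
    q = Poly₂.coeff Q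
    E = eval₂ N q x y
    γq = λ i j → γ * q i j
    X Y : ℕ → ℕ → Carrier
    X i j = shift (λ i′ → α * q i′ j) i
    Y i j = shift (λ j′ → β * q i j′) j

    split : ∀ i j → linMulCoeff α β γ Q i j ≈ (X i j + Y i j) + γ * q i j
    split zero   zero   = refl
    split zero   (1+ j) = refl
    split (1+ i) zero   = refl
    split (1+ i) (1+ j) = refl

    q≈0 : ∀ i j → m < i ℕ.+ j → q i j ≈ 0#
    q≈0 i j m<i+j = Poly₂.finite Q i j (ℕ.≤-<-trans bound≤m m<i+j)

    X-part : eval₂ N X x y ≈ x * (α * E)
    X-part = trans (eval₂-shiftˣ m (λ i j → α * q i j) x y α*q-top≈0) (*-congˡ (eval₂-* N α q x y))
      where
      α*q-top≈0 : ∀ j → α * q N j ≈ 0#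
      α*q-top≈0 j = trans (*-congˡ (q≈0 N j (s≤s (ℕ.m≤m+n m j)))) (zeroʳ α)

    Y-part : eval₂ N Y x y ≈ y * (β * E)
    Y-part = trans (eval₂-shiftʸ m (λ i j → β * q i j) x y β*q-top≈0) (*-congˡ (eval₂-* N β q x y))
      where
      β*q-top≈0 : ∀ i → β * q i N ≈ 0#
      β*q-top≈0 i = trans (*-congˡ (q≈0 i N (ℕ.m≤n+m N i))) (zeroʳ β)

  coeffK : ∀ {d} → Vec ℤ (1+ d) → ℕ → Carrier
  coeffK P i = ℤ→K (coeffℤ P i)

  coeffK-high : ∀ {d} (P : Vec ℤ (1+ d)) k → d < k → coeffK P k ≈ 0#
  coeffK-high {d} P k d<k with k ℕ.<? 1+ d
  ... | yes k<1+d = ⊥-elim (ℕ.<-irrefl ≡.refl (ℕ.<-≤-trans d<k (ℕ.≤-pred k<1+d)))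
  ... | no _      = refl

  coeffK-lead≉0 : CharZero → ∀ {d} (P : Vec ℤ (1+ d)) → 0ℤ <ℤ leadℤ P → ¬ coeffK P d ≈ 0#
  coeffK-lead≉0 char0 {d} P lead>0 with d ℕ.<? 1+ d
  ... | yes d<1+d = ℤ→K-positive≉0 char0 _ (≡.subst (0ℤ <ℤ_) (≡.cong (lookup P) lead-index) lead>0)
    where
    lead-index : fromℕ d ≡ fromℕ< d<1+d
    lead-index = ≡.trans (Fin.fromℕ-def d) (Fin.fromℕ<-cong d d ≡.refl ℕ.≤-refl d<1+d)
  ... | no d≮1+d = ⊥-elim (d≮1+d ℕ.≤-refl)

  eval₂-diffPoly : ∀ a b {d} (P : Vec ℤ (1+ d)) m x y →
    eval₂ (1+ m) (diffPoly K a b P) x y ≈ ℕ→K a * evalK (1+ m) (coeffK P) y - ℕ→K b * evalK (1+ m) (coeffK P) x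
  eval₂-diffPoly a b P m x y = begin
    evalK N H y
      ≈⟨ evalK-suc m H y ⟩
    H 0 + y * evalK m (λ j → H (1+ j)) y
      ≈⟨ +-cong row₀ (*-congˡ (trans (evalK-cong m (λ j _ → row-suc j) y) (evalK-* m A _ y))) ⟩
    (A * C 0 - B * evalK N C x) + y * (A * evalK m (λ j → C (1+ j)) y)
      ≈⟨ solve 6 (λ A B c₀ p y t → (A :* c₀ :- B :* p) :+ y :* (A :* t) := A :* (c₀ :+ y :* t) :- B :* p) refl A B (C 0) _ y _ ⟩
    A * (C 0 + y * evalK m (λ j → C (1+ j)) y) - B * evalK N C x
      ≈⟨ +-congʳ (*-congˡ (evalK-suc m C y)) ⟨
    A * evalK N C y - B * evalK N C x
      ∎
    where
    N = 1+ m
    A = ℕ→K a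
    B = ℕ→K b
    C = coeffK P
    F = diffPoly K a b P

    H : ℕ → Carrier
    H j = evalK N (λ i → F i j) x

    row₀ : H 0 ≈ A * C 0 - B * evalK N C x
    row₀ = begin
      H 0
        ≈⟨ evalK-suc m _ x ⟩
      F 0 0 + x * evalK m (λ i → F (1+ i) 0) x
        ≈⟨ +-cong F₀₀ (*-congˡ (trans (evalK-cong m (λ i _ → Fᵢ₀ i) x) (evalK-* m (- B) _ x))) ⟩
      (A - B) * C 0 + x * (- B * evalK m (λ i → C (1+ i)) x)
        ≈⟨ solve 5 (λ A B c₀ x t → (A :- B) :* c₀ :+ x :* ((:- B) :* t) := A :* c₀ :- B :* (c₀ :+ x :* t)) refl A B (C 0) x _ ⟩
      A * C 0 - B * (C 0 + x * evalK m (λ i → C (1+ i)) x)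
        ≈⟨ +-congˡ (-‿cong (*-congˡ (evalK-suc m C x))) ⟨
      A * C 0 - B * evalK N C x
        ∎
      where
      F₀₀ : F 0 0 ≈ (A - B) * C 0
      F₀₀ = trans (ℤ→K-* (+ a ℤ.- + b) _) (*-congʳ (trans (ℤ→K-+ (+ a) (ℤ.- + b)) (+-congˡ (ℤ→K-neg (+ b)))))
      Fᵢ₀ : ∀ i → F (1+ i) 0 ≈ - B * C (1+ i)
      Fᵢ₀ i = trans (ℤ→K-neg (+ b ℤ.* coeffℤ P (1+ i))) (trans (-‿cong (ℤ→K-* (+ b) _)) (-‿distribˡ-* _ _))

    row-suc : ∀ j → H (1+ j) ≈ A * C (1+ j)
    row-suc j = begin
      H (1+ j)                                      ≈⟨ evalK-suc m _ x ⟩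
      F 0 (1+ j) + x * evalK m (λ i → 0#) x         ≈⟨ +-cong (ℤ→K-* (+ a) _) (*-congˡ (evalK-zero m _ x λ _ → refl)) ⟩
      A * C (1+ j) + x * 0#                         ≈⟨ +-congˡ (zeroʳ x) ⟩
      A * C (1+ j) + 0#                             ≈⟨ +-identityʳ _ ⟩
      A * C (1+ j)                                  ∎

  linearFactor⇒lineRelation : ∀ a b {d} (P : Vec ℤ (1+ d)) → HasLinearFactor (diffPoly K a b P) →
    Σ Carrier λ α → Σ Carrier λ β → Σ Carrier λ γ → (¬ α ≈ 0# ⊎ ¬ β ≈ 0#) ×
      (∀ x y → α * x + β * y + γ ≈ 0# → ℕ→K a * evalℤK K P y ≈ ℕ→K b * evalℤK K P x)
  linearFactor⇒lineRelation a b {d} P (α , β , γ , α≉0⊎β≉0 , Q , Q-divides) =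
    α , β , γ , α≉0⊎β≉0 , λ x y onLine → x∙y⁻¹≈ε⇒x≈y _ _ (begin
      A * p y - B * p x                              ≈⟨ +-cong (*-congˡ (extend y)) (-‿cong (*-congˡ (extend x))) ⟨
      A * evalK N C y - B * evalK N C x              ≈⟨ eval₂-diffPoly a b P m x y ⟨
      eval₂ N (diffPoly K a b P) x y                 ≈⟨ eval₂-cong N (λ i j → sym (Q-divides i j)) x y ⟩
      eval₂ N (linMulCoeff α β γ Q) x y              ≈⟨ eval₂-linMulCoeff α β γ Q m (ℕ.m≤m+n _ d) x y ⟩
      (α * x + β * y + γ) * eval₂ N (Poly₂.coeff Q) x y ≈⟨ *-congʳ onLine ⟩
      0# * eval₂ N (Poly₂.coeff Q) x y               ≈⟨ zeroˡ _ ⟩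
      0#                                             ∎)
    where
    m = Poly₂.bound Q ℕ.+ d
    N = 1+ m
    A = ℕ→K a
    B = ℕ→K b
    C = coeffK P
    p = evalℤK K P
    extend : ∀ t → evalK N C t ≈ p t
    extend t = evalK-extend (1+ (Poly₂.bound Q)) d C t (coeffK-high P)

  -- The factor theorem and counting roots

  truncate : ℕ → (ℕ → Carrier) → ℕ → Carrier
  truncate m g k with k ℕ.≤? m
  ... | yes _ = g k
  ... | no _  = 0#

  truncate-≤ : ∀ m g k → k ≤ m → truncate m g k ≈ g k
  truncate-≤ m g k k≤m with k ℕ.≤? m
  ... | yes _  = refl
  ... | no k≰m = ⊥-elim (k≰m k≤m)

  truncate-top : ∀ m g → truncate m g (1+ m) ≈ 0#
  truncate-top m g with 1+ m ℕ.≤? m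
  ... | yes 1+m≤m = ⊥-elim (ℕ.1+n≰n 1+m≤m)
  ... | no _      = refl

  evalK-truncate : ∀ m g x → evalK (1+ m) (truncate m g) x ≈ evalK m g x
  evalK-truncate m g x = trans (evalK-dropTop m _ x (truncate-top m g)) (evalK-cong m (truncate-≤ m g) x)

  factorTheorem : ∀ m f c → Σ (ℕ → Carrier) λ h →
    (∀ x → evalK (1+ m) f x - evalK (1+ m) f c ≈ (x - c) * evalK m h x) × h m ≈ f (1+ m)
  factorTheorem zero f c = (λ _ → f 1) , divides , refl
    where
    divides : ∀ x → evalK 1 f x - evalK 1 f c ≈ (x - c) * f 1
    divides x = begin
      (f 0 + f 1 * (x * 1#)) - (f 0 + f 1 * (c * 1#))
        ≈⟨ +-cong (+-congˡ (*-congˡ (*-identityʳ x))) (-‿cong (+-congˡ (*-congˡ (*-identityʳ c)))) ⟩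
      (f 0 + f 1 * x) - (f 0 + f 1 * c)
        ≈⟨ solve 4 (λ f₀ f₁ x c → (f₀ :+ f₁ :* x) :- (f₀ :+ f₁ :* c) := (x :- c) :* f₁) refl (f 0) (f 1) x c ⟩
      (x - c) * f 1
        ∎
  factorTheorem (1+ m) f c with factorTheorem m (λ k → f (1+ k)) c
  ... | h′ , h′-divides , h′-lead = h , divides , h-lead
    where
    f′ = λ k → f (1+ k)
    h : ℕ → Carrier
    h k = f′ k + c * truncate m h′ k

    h-lead : h (1+ m) ≈ f (2 ℕ.+ m)
    h-lead = trans (+-congˡ (trans (*-congˡ (truncate-top m h′)) (zeroʳ c))) (+-identityʳ _)

    divides : ∀ x → evalK (2 ℕ.+ m) f x - evalK (2 ℕ.+ m) f c ≈ (x - c) * evalK (1+ m) h x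
    divides x = begin
      evalK (2 ℕ.+ m) f x - evalK (2 ℕ.+ m) f c
        ≈⟨ +-cong (evalK-suc (1+ m) f x) (-‿cong (evalK-suc (1+ m) f c)) ⟩
      (f 0 + x * F x) - (f 0 + c * F c)
        ≈⟨ solve 5 (λ f₀ x c Fx Fc → (f₀ :+ x :* Fx) :- (f₀ :+ c :* Fc) := (x :- c) :* Fx :+ c :* (Fx :- Fc)) refl (f 0) x c (F x) (F c) ⟩
      (x - c) * F x + c * (F x - F c)
        ≈⟨ +-congˡ (*-congˡ (h′-divides x)) ⟩
      (x - c) * F x + c * ((x - c) * evalK m h′ x)
        ≈⟨ solve 4 (λ x c Fx H → (x :- c) :* Fx :+ c :* ((x :- c) :* H) := (x :- c) :* (Fx :+ c :* H)) refl x c (F x) _ ⟩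
      (x - c) * (F x + c * evalK m h′ x)
        ≈⟨ *-congˡ (+-congˡ (*-congˡ (evalK-truncate m h′ x))) ⟨
      (x - c) * (F x + c * evalK (1+ m) (truncate m h′) x)
        ≈⟨ *-congˡ (trans (evalK-+ (1+ m) f′ _ x) (+-congˡ (evalK-* (1+ m) c _ x))) ⟨
      (x - c) * evalK (1+ m) h x
        ∎
      where
      F : Carrier → Carrier
      F = evalK (1+ m) f′

  roots-not-distinct : ∀ n f → ¬ f n ≈ 0# → (g : ℕ → Carrier) → (∀ i → i ≤ n → evalK n f (g i) ≈ 0#) →
                       ¬ (∀ i j → i < j → j ≤ n → ¬ g i ≈ g j)
  roots-not-distinct zero    f lead≉0 g roots distinct = lead≉0 (roots 0 z≤n)
  roots-not-distinct (1+ m) f lead≉0 g roots distinct with factorTheorem m f (g 0)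
  ... | h , h-divides , h-lead =
    roots-not-distinct m h (λ h-lead≈0 → lead≉0 (trans (sym h-lead) h-lead≈0)) (λ i → g (1+ i)) roots′
      (λ i j i<j j≤m → distinct (1+ i) (1+ j) (s≤s i<j) (s≤s j≤m))
    where
    roots′ : ∀ i → i ≤ m → evalK m h (g (1+ i)) ≈ 0#
    roots′ i i≤m = x≉0⇒x*y≈0⇒y≈0 gᵢ-g₀≉0 (begin
      (g (1+ i) - g 0) * evalK m h (g (1+ i))                ≈⟨ h-divides (g (1+ i)) ⟨
      evalK (1+ m) f (g (1+ i)) - evalK (1+ m) f (g 0)       ≈⟨ +-cong (roots (1+ i) (s≤s i≤m)) (-‿cong (roots 0 z≤n)) ⟩
      0# - 0#                                               ≈⟨ -‿inverseʳ 0# ⟩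
      0#                                                    ∎)
      where
      gᵢ-g₀≉0 : ¬ g (1+ i) - g 0 ≈ 0#
      gᵢ-g₀≉0 e = distinct 0 (1+ i) (s≤s z≤n) (s≤s i≤m) (sym (x∙y⁻¹≈ε⇒x≈y _ _ e))

  minusConstant : (ℕ → Carrier) → Carrier → ℕ → Carrier
  minusConstant f t zero   = f 0 - t
  minusConstant f t (1+ k) = f (1+ k)

  evalK-minusConstant : ∀ n f t x → evalK n (minusConstant f t) x ≈ evalK n f x - t
  evalK-minusConstant zero    f t x = refl
  evalK-minusConstant (1+ n) f t x = trans (+-congʳ (evalK-minusConstant n f t x))
    (solve 3 (λ e t a → (e :- t) :+ a := (e :+ a) :- t) refl (evalK n f x) t (f (1+ n) * x ^ 1+ n))

  evalK-surjective : AlgClosed → ∀ m f → ¬ f (1+ m) ≈ 0# → ∀ t → ∃ λ x → evalK (1+ m) f x ≈ t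
  evalK-surjective closed m f lead≉0 t with closed m (minusConstant f t) lead≉0
  ... | x , root = x , x∙y⁻¹≈ε⇒x≈y _ _ (trans (sym (evalK-minusConstant (1+ m) f t x)) root)

  -- Iterates of an affine map

  affine-fixing-two-points≈id : ∀ {κ μ r s} → ¬ r ≈ s → κ * r + μ ≈ r → κ * s + μ ≈ s → ∀ x → κ * x + μ ≈ x
  affine-fixing-two-points≈id {κ} {μ} {r} {s} r≉s r-fixed s-fixed x = begin
    κ * x + μ    ≈⟨ +-cong (trans (*-congʳ κ≈1) (*-identityˡ x)) μ≈0 ⟩
    x + 0#       ≈⟨ +-identityʳ x ⟩
    x            ∎
    where
    κ≈1 : κ ≈ 1#
    κ≈1 = x∙y⁻¹≈ε⇒x≈y _ _ (x≉0⇒x*y≈0⇒y≈0 (λ r-s≈0 → r≉s (x∙y⁻¹≈ε⇒x≈y _ _ r-s≈0)) (begin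
      (r - s) * (κ - 1#)
        ≈⟨ solve 5 (λ r s κ μ one → (r :- s) :* (κ :- one) := ((κ :* r :+ μ) :- (κ :* s :+ μ)) :- (r :- s) :* one) refl r s κ μ 1# ⟩
      ((κ * r + μ) - (κ * s + μ)) - (r - s) * 1#  ≈⟨ +-cong (+-cong r-fixed (-‿cong s-fixed)) (-‿cong (*-identityʳ _)) ⟩
      (r - s) - (r - s)                      ≈⟨ -‿inverseʳ _ ⟩
      0#                                     ∎))
    μ≈0 : μ ≈ 0#
    μ≈0 = begin
      μ                     ≈⟨ solve 3 (λ κ r μ → μ := (κ :* r :+ μ) :- κ :* r) refl κ r μ ⟩
      (κ * r + μ) - κ * r   ≈⟨ +-cong r-fixed (-‿cong (trans (*-congʳ κ≈1) (*-identityˡ r))) ⟩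
      r - r                 ≈⟨ -‿inverseʳ r ⟩
      0#                    ∎

  module AffineMap (κ μ : Carrier) where

    σ : Carrier → Carrier
    σ x = κ * x + μ

    σ^ : ℕ → Carrier → Carrier
    σ^ n x = fold x σ n

    σ^-cong : ∀ n {x y} → x ≈ y → σ^ n x ≈ σ^ n y
    σ^-cong zero    x≈y = x≈y
    σ^-cong (1+ n) x≈y = +-congʳ (*-congˡ (σ^-cong n x≈y))

    σ^-injective : ¬ κ ≈ 0# → ∀ n {x y} → σ^ n x ≈ σ^ n y → x ≈ y
    σ^-injective κ≉0 zero    e = e
    σ^-injective κ≉0 (1+ n) e = σ^-injective κ≉0 n (x∙y⁻¹≈ε⇒x≈y _ _ (x≉0⇒x*y≈0⇒y≈0 κ≉0 (begin
      κ * (σ^ n _ - σ^ n _)                     ≈⟨ solve 4 (λ κ μ a b → κ :* (a :- b) := (κ :* a :+ μ) :- (κ :* b :+ μ)) refl κ μ _ _ ⟩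
      σ^ (1+ n) _ - σ^ (1+ n) _                 ≈⟨ x≈y⇒x∙y⁻¹≈ε e ⟩
      0#                                        ∎)))

    translation : ℕ → Carrier
    translation zero   = 0#
    translation (1+ n) = κ * translation n + μ

    σ^-affine : ∀ n x → σ^ n x ≈ κ ^ n * x + translation n
    σ^-affine zero    x = sym (trans (+-identityʳ _) (*-identityˡ x))
    σ^-affine (1+ n) x = begin
      κ * σ^ n x + μ                            ≈⟨ +-congʳ (*-congˡ (σ^-affine n x)) ⟩
      κ * (κ ^ n * x + translation n) + μ       ≈⟨ solve 5 (λ κ K x t μ → κ :* (K :* x :+ t) :+ μ := (κ :* K) :* x :+ (κ :* t :+ μ)) refl κ (κ ^ n) x (translation n) μ ⟩
      κ ^ 1+ n * x + translation (1+ n)         ∎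

    σ^-fixed-multiple : ∀ k z → σ^ k z ≈ z → ∀ t → σ^ (t ℕ.* k) z ≈ z
    σ^-fixed-multiple k z fixed zero    = refl
    σ^-fixed-multiple k z fixed (1+ t) = begin
      σ^ (k ℕ.+ t ℕ.* k) z       ≡⟨ fold-+ z σ k ⟩
      σ^ k (σ^ (t ℕ.* k) z)      ≈⟨ σ^-cong k (σ^-fixed-multiple k z fixed t) ⟩
      σ^ k z                     ≈⟨ fixed ⟩
      z                          ∎

    σ^-return : ¬ κ ≈ 0# → ∀ i k z → σ^ i z ≈ σ^ (1+ (i ℕ.+ k)) z → σ^ (1+ k) z ≈ z
    σ^-return κ≉0 i k z e = σ^-injective κ≉0 i (begin
      σ^ i (σ^ (1+ k) z)     ≡⟨ fold-+ z σ i ⟨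
      σ^ (i ℕ.+ 1+ k) z      ≡⟨ ≡.cong (λ n → σ^ n z) (ℕ.+-suc i k) ⟩
      σ^ (1+ (i ℕ.+ k)) z    ≈⟨ e ⟨
      σ^ i z                 ∎)

  -- A polynomial related to itself along a line

  module _ (n : ℕ) (f : ℕ → Carrier) (lead≉0 : ¬ f n ≈ 0#) {x₁ r s : Carrier}
           (p[x₁]≈1 : evalK n f x₁ ≈ 1#) (r≉s : ¬ r ≈ s)
           (p[r]≈0 : evalK n f r ≈ 0#) (p[s]≈0 : evalK n f s ≈ 0#) where

    private
      p : Carrier → Carrier
      p = evalK n f

    scaled-constant⇒scale≈0 : ∀ w t → (∀ y → w * p y ≈ t) → w ≈ 0#
    scaled-constant⇒scale≈0 w t constant = begin
      w            ≈⟨ *-identityʳ w ⟨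
      w * 1#       ≈⟨ *-congˡ p[x₁]≈1 ⟨
      w * p x₁     ≈⟨ constant x₁ ⟩
      t            ≈⟨ constant r ⟨
      w * p r      ≈⟨ *-congˡ p[r]≈0 ⟩
      w * 0#       ≈⟨ zeroʳ w ⟩
      0#           ∎

    module _ {κ μ u v : Carrier} (κ≉0 : ¬ κ ≈ 0#) (u≉0 : ¬ u ≈ 0#)
             (related : ∀ x → u * p (κ * x + μ) ≈ v * p x) where
      open AffineMap κ μ

      σ^-preserves-roots : ∀ k {z} → p z ≈ 0# → p (σ^ k z) ≈ 0#
      σ^-preserves-roots zero    root = root
      σ^-preserves-roots (1+ k) root = x≉0⇒x*y≈0⇒y≈0 u≉0
        (trans (related _) (trans (*-congˡ (σ^-preserves-roots k root)) (zeroʳ v)))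

      root-periodic : ∀ {z} → p z ≈ 0# → ¬ ¬ ∃ λ k → σ^ (1+ k) z ≈ z
      root-periodic {z} root aperiodic =
        roots-not-distinct n f lead≉0 (λ i → σ^ i z) (λ i _ → σ^-preserves-roots i root) distinct
        where
        distinct : ∀ i j → i < j → j ≤ n → ¬ σ^ i z ≈ σ^ j z
        distinct i (1+ j) (s≤s i≤j) _ e = aperiodic (j ∸ i , σ^-return κ≉0 i (j ∸ i) z
          (≡.subst (λ m → σ^ i z ≈ σ^ (1+ m) z) (≡.sym (ℕ.m+[n∸m]≡n i≤j)) e))

      related-iterate : ∀ k x → u ^ k * p (σ^ k x) ≈ v ^ k * p x
      related-iterate zero    x = refl
      related-iterate (1+ k) x = begin
        (u * u ^ k) * p (σ (σ^ k x))    ≈⟨ solve 3 (λ u uᵏ q → (u :* uᵏ) :* q := uᵏ :* (u :* q)) refl u (u ^ k) _ ⟩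
        u ^ k * (u * p (σ (σ^ k x)))    ≈⟨ *-congˡ (related (σ^ k x)) ⟩
        u ^ k * (v * p (σ^ k x))        ≈⟨ solve 3 (λ uᵏ v q → uᵏ :* (v :* q) := v :* (uᵏ :* q)) refl (u ^ k) v _ ⟩
        v * (u ^ k * p (σ^ k x))        ≈⟨ *-congˡ (related-iterate k x) ⟩
        v * (v ^ k * p x)               ≈⟨ *-assoc _ _ _ ⟨
        (v * v ^ k) * p x               ∎

      affineRelation⇒equalPowers : ¬ ¬ ∃ λ k → u ^ 1+ k ≈ v ^ 1+ k
      affineRelation⇒equalPowers noEqualPowers =
        root-periodic p[r]≈0 λ (k , r-periodic) → root-periodic p[s]≈0 λ (k′ , s-periodic) →
          let N = 1+ k′ ℕ.* 1+ k

              r-fixed : σ^ N r ≈ r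
              r-fixed = σ^-fixed-multiple (1+ k) r r-periodic (1+ k′)

              s-fixed : σ^ N s ≈ s
              s-fixed = ≡.subst (λ m → σ^ m s ≈ s) (ℕ.*-comm (1+ k) (1+ k′))
                                (σ^-fixed-multiple (1+ k′) s s-periodic (1+ k))

              σᴺ≈id : ∀ x → σ^ N x ≈ x
              σᴺ≈id x = trans (σ^-affine N x) (affine-fixing-two-points≈id r≉s
                (trans (sym (σ^-affine N r)) r-fixed) (trans (sym (σ^-affine N s)) s-fixed) x)
          in noEqualPowers (k ℕ.+ k′ ℕ.* 1+ k , (begin
            u ^ N                ≈⟨ *-identityʳ _ ⟨
            u ^ N * 1#           ≈⟨ *-congˡ (trans (evalK-congʳ n f (σᴺ≈id x₁)) p[x₁]≈1) ⟨
            u ^ N * p (σ^ N x₁)  ≈⟨ related-iterate N x₁ ⟩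
            v ^ N * p x₁         ≈⟨ *-congˡ p[x₁]≈1 ⟩
            v ^ N * 1#           ≈⟨ *-identityʳ _ ⟩
            v ^ N                ∎))

    lineRelation⇒equalPowers : ∀ {α β γ u v} → ¬ u ≈ 0# → ¬ v ≈ 0# → (¬ α ≈ 0# ⊎ ¬ β ≈ 0#) →
      (∀ x y → α * x + β * y + γ ≈ 0# → u * p y ≈ v * p x) → ¬ ¬ ∃ λ k → u ^ 1+ k ≈ v ^ 1+ k
    lineRelation⇒equalPowers {α} {β} {γ} {u} {v} u≉0 v≉0 α≉0⊎β≉0 related =
      graphCase (inverse β β≉0)
      where
      verticalCase : (∃ λ α⁻¹ → α * α⁻¹ ≈ 1#) → β ≈ 0# → ⊥
      verticalCase (α⁻¹ , αα⁻¹≈1) β≈0 =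
        u≉0 (scaled-constant⇒scale≈0 u (v * p x₀) (λ y → related x₀ y (onLine y)))
        where
        x₀ = - (γ * α⁻¹)
        onLine : ∀ y → α * x₀ + β * y + γ ≈ 0#
        onLine y = begin
          α * x₀ + β * y + γ       ≈⟨ solve 3 (λ a b c → a :+ b :+ c := (a :+ c) :+ b) refl _ _ γ ⟩
          (α * x₀ + γ) + β * y     ≈⟨ +-cong (x*[-y*x⁻¹]+y≈0 αα⁻¹≈1 γ) (trans (*-congʳ β≈0) (zeroˡ y)) ⟩
          0# + 0#                  ≈⟨ +-identityʳ 0# ⟩
          0#                       ∎

      β≉0 : ¬ β ≈ 0#
      β≉0 β≈0 = [ (λ α≉0 → verticalCase (inverse α α≉0) β≈0) , (λ β≉0 → β≉0 β≈0) ] α≉0⊎β≉0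

      graphCase : (∃ λ β⁻¹ → β * β⁻¹ ≈ 1#) → ¬ ¬ ∃ λ k → u ^ 1+ k ≈ v ^ 1+ k
      graphCase (β⁻¹ , ββ⁻¹≈1) = affineRelation⇒equalPowers κ≉0 u≉0 (λ x → related x _ (onGraph x))
        where
        κ = - (α * β⁻¹)
        μ = - (γ * β⁻¹)
        onGraph : ∀ x → α * x + β * (κ * x + μ) + γ ≈ 0#
        onGraph x = trans
          (solve 5 (λ α β β⁻¹ γ x → α :* x :+ β :* ((:- (α :* β⁻¹)) :* x :+ (:- (γ :* β⁻¹))) :+ γ
                                    := β :* (:- ((α :* x :+ γ) :* β⁻¹)) :+ (α :* x :+ γ)) refl α β β⁻¹ γ x)
          (x*[-y*x⁻¹]+y≈0 ββ⁻¹≈1 (α * x + γ))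
        α≉0 : ¬ α ≈ 0#
        α≉0 α≈0 = v≉0 (scaled-constant⇒scale≈0 v (u * p μ) λ x → trans (sym (related x _ (onGraph x)))
          (*-congˡ (evalK-congʳ n f (trans (+-congʳ (trans (*-congʳ κ≈0) (zeroˡ x))) (+-identityˡ μ)))))
          where
          κ≈0 : κ ≈ 0#
          κ≈0 = trans (-‿cong (trans (*-congʳ α≈0) (zeroˡ β⁻¹))) ε⁻¹≈ε
        κ≉0 : ¬ κ ≈ 0#
        κ≉0 = -x≉0 (x*y≉0 α≉0 (x*y≈1⇒y≉0 ββ⁻¹≈1))

lemma2p4 : ∀ {c ℓ} (K : Field c ℓ) → FieldOps.CharZero K → FieldOps.AlgClosed K →
    ∀ (d : ℕ) (P : Vec ℤ (1+ d)) → 2 ≤ d → 0ℤ <ℤ leadℤ P →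
    (∃₂ λ r s → ¬ (Field._≈_ K r s) × Field._≈_ K (evalℤK K P r) (Field.0# K) × Field._≈_ K (evalℤK K P s) (Field.0# K)) →
    (∀ (n : ℕ) → 0ℤ <ℤ evalℤ P +[1+ n ]) →
    ∀ (a b : ℕ) → 1 ≤ a → 1 ≤ b → a ≢ b →
    ¬ FieldOps.HasLinearFactor K (diffPoly K a b P)
lemma2p4 K char0 closed zero P ()
lemma2p4 K char0 closed (1+ m) P _ lead>0 (r , s , r≉s , p[r]≈0 , p[s]≈0) _ (1+ a) (1+ b) _ _ a≢b hasFactor =
  let lead≉0                               = coeffK-lead≉0 K char0 P lead>0
      x₁ , p[x₁]≈1                         = evalK-surjective K closed m (coeffK K P) lead≉0 (Field.1# K)
      α , β , γ , α≉0⊎β≉0 , onLine⇒related = linearFactor⇒lineRelation K (1+ a) (1+ b) P hasFactor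
  in lineRelation⇒equalPowers K (1+ m) (coeffK K P) lead≉0 p[x₁]≈1 r≉s p[r]≈0 p[s]≈0
       (char0 a) (char0 b) α≉0⊎β≉0 onLine⇒related
       (λ (k , equalPowers) → a≢b (ℕ→K-equalPowers⇒≡ K char0 (1+ a) (1+ b) k equalPowers))
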